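{- Let $\phi:\mathcal{S}_{\mathcal{A}}\to\mathcal{S}_{\mathcal{B}}$ be an epimorphism of finite semigroups, let $\mathcal{C}\subseteq\mathcal{S}_{\mathcal{A}}$ be a left ideal, and let $w$ be a probability measure on $\mathcal{S}_{\mathcal{A}}$. Let $(X_t)$ be the semigroup walk on $\mathcal{C}$ associated to $w$. Then for every starting distribution on $\mathcal{C}$, the process $(\phi(X_t))$ on $\phi(\mathcal{C})$ is a Markov chain. Moreover, this induced chain is itself the semigroup walk on $\phi(\mathcal{C})$ associated to the probability measure $w^*$ on $\mathcal{S}_{\mathcal{B}}$ defined by $w^*(z)=\sum_{x\in\mathcal{S}_{\mathcal{A}}:\,\phi(x)=z}w(x)$.
   Context: An epimorphism of semigroups is a surjective map $\phi$ with $\phi(xy)=\phi(x)\phi(y)$. A left ideal of a semigroup $\mathcal{S}$ is a nonempty subset $\mathcal{C}$ with $x c\in\mathcal{C}$ for all $x\in\mathcal{S}$, $c\in\mathcal{C}$ (so $\phi(\mathcal{C})$ is a left ideal of $\mathcal{S}_{\mathcal{B}}$). Given a finite semigroup $\mathcal{S}$, a left ideal $\mathcal{C}$ and a probability measure $w$ on $\mathcal{S}$, the semigroup walk on $\mathcal{C}$ associated to $w$ is the Markov chain on $\mathcal{C}$ with transition matrix $K(c,c')=\sum_{x\in\mathcal{S}:\,xc=c'}w(x)$.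
   Formalization: The probability measure w and the starting distribution on $\mathcal{C}$ take rational values. -}

module Defs where

open import Data.Nat using (ℕ; zero; suc)
open import Data.Fin using (Fin; zero; suc; _≟_)
open import Data.Vec using (Vec; []; _∷_; map)
open import Data.Vec.Properties using (≡-dec)
open import Data.Rational using (ℚ; 0ℚ; 1ℚ; _+_; _*_; _≤_)
open import Data.Bool using (Bool; true)
open import Data.Sum using (_⊎_)
open import Data.Product using (Σ; ∃; _×_; _,_)
open import Relation.Binary.PropositionalEquality using (_≡_)
open import Relation.Nullary using (Dec; yes; no)

sumFin : (n : ℕ) → (Fin n → ℚ) → ℚ
sumFin zero    f = 0ℚ
sumFin (suc n) f = f zero + sumFin n (λ i → f (suc i))

sumVecs : (n t : ℕ) → (Vec (Fin n) t → ℚ) → ℚ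
sumVecs n zero    f = f []
sumVecs n (suc t) f = sumFin n (λ c → sumVecs n t (λ cs → f (c ∷ cs)))

when : ∀ {p} {P : Set p} → Dec P → ℚ → ℚ
when (yes _) q = q
when (no _)  q = 0ℚ

record FinSemigroup : Set where
  field
    size  : ℕ
    _∙_   : Fin size → Fin size → Fin size
    assoc : ∀ x y z → (x ∙ y) ∙ z ≡ x ∙ (y ∙ z)

open FinSemigroup public

IsEpimorphism : (A B : FinSemigroup) → (Fin (size A) → Fin (size B)) → Set
IsEpimorphism A B φ =
  (∀ x y → φ (_∙_ A x y) ≡ _∙_ B (φ x) (φ y)) × (∀ z → ∃ λ x → φ x ≡ z)

IsLeftIdeal : (A : FinSemigroup) → (Fin (size A) → Bool) → Set
IsLeftIdeal A C =
  (∃ λ c → C c ≡ true) × (∀ x c → C c ≡ true → C (_∙_ A x c) ≡ true)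

IsProbability : (n : ℕ) → (Fin n → ℚ) → Set
IsProbability n w = (∀ x → 0ℚ ≤ w x) × (sumFin n w ≡ 1ℚ)

IsDistributionOn : (n : ℕ) → (Fin n → Bool) → (Fin n → ℚ) → Set
IsDistributionOn n C μ = IsProbability n μ × (∀ c → μ c ≡ 0ℚ ⊎ C c ≡ true)

walkK : (A : FinSemigroup) → (Fin (size A) → ℚ) → Fin (size A) → Fin (size A) → ℚ
walkK A w c c' = sumFin (size A) (λ x → when (_∙_ A x c ≟ c') (w x))

stepsW : ∀ {n t} → (Fin n → Fin n → ℚ) → Fin n → Vec (Fin n) t → ℚ
stepsW K c []        = 1ℚ
stepsW K c (c' ∷ cs) = K c c' * stepsW K c' cs

-- P(X_0 = c_0, ..., X_t = c_t) for the Markov chain with initial law μ and kernel K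
pathLaw : ∀ {n t} → (Fin n → ℚ) → (Fin n → Fin n → ℚ) → Vec (Fin n) (suc t) → ℚ
pathLaw μ K (c ∷ cs) = μ c * stepsW K c cs

pushforward : ∀ {n m} → (Fin n → Fin m) → (Fin n → ℚ) → Fin m → ℚ
pushforward {n} φ w z = sumFin n (λ x → when (φ x ≟ z) (w x))

-- P(φ(X_0) = b_0, ..., φ(X_t) = b_t)
imageLaw : ∀ {n m} t → (Fin n → Fin m) → (Fin n → ℚ) → (Fin n → Fin n → ℚ)
           → Vec (Fin m) (suc t) → ℚ
imageLaw {n} t φ μ K bs =
  sumVecs n (suc t) (λ cs → when (≡-dec _≟_ (map φ cs) bs) (pathLaw μ K cs))

InImage : ∀ {n m} → (Fin n → Fin m) → (Fin n → Bool) → Fin m → Set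
InImage φ C b = ∃ λ c → (C c ≡ true) × (φ c ≡ b)

-- The projected chain is Markov by Dynkin's lumpability criterion: if the mass K(c, ·) puts on
-- each fibre of φ depends on c only through φ c, say it is K*(φ c, ·), then summing the path
-- law over all paths above b₀ … b_t collapses, one step at a time from the end, to the path law
-- of K* started from the image of the initial law. For a semigroup walk the criterion holds
-- because φ (x c) = φ x · φ c: the mass that K(c, ·) puts on the fibre over b' is the w-mass
-- of {x : φ x · φ c = b'}, which is the w*-mass of {z : z · φ c = b'}.
module Submission where

open import Defs
open import Data.Nat using (ℕ; zero; suc)
open import Data.Fin using (Fin; zero; suc; _≟_)
open import Data.Vec using (Vec; []; _∷_; map; head; tail)
open import Data.Vec.Properties using (≡-dec)
open import Data.Vec.Relation.Unary.All using (All)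
open import Data.Bool using (Bool)
open import Data.Rational using (ℚ; 0ℚ; _+_; _*_)
open import Data.Rational.Properties
  using (+-identityˡ; +-identityʳ; *-zeroˡ; *-zeroʳ; +-*-commutativeRing)
open import Data.Product using (_,_)
open import Algebra.Bundles using (CommutativeRing)
open import Algebra.Properties.Semiring.Sum (CommutativeRing.semiring +-*-commutativeRing)
  using (sum; sum-cong-≗; sum-replicate-zero; ∑-comm; *-distribˡ-sum; *-distribʳ-sum)
open import Function using (_∘_)
open import Relation.Nullary using (Dec; yes; no; map′; _×-dec_)
open import Relation.Binary.PropositionalEquality
  using (_≡_; _≗_; refl; sym; trans; cong; cong₂; module ≡-Reasoning)
open ≡-Reasoning

when-map′ : ∀ {p q} {P : Set p} {Q : Set q} {f : P → Q} {g : Q → P} (d : Dec P) {r : ℚ} →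
            when (map′ f g d) r ≡ when d r
when-map′ (yes _) = refl
when-map′ (no _)  = refl

when-×-dec : ∀ {p q} {P : Set p} {Q : Set q} (d : Dec P) (e : Dec Q) {r : ℚ} →
             when (d ×-dec e) r ≡ when d (when e r)
when-×-dec (yes _) (yes _) = refl
when-×-dec (yes _) (no _)  = refl
when-×-dec (no _)  _       = refl

when-comm : ∀ {p q} {P : Set p} {Q : Set q} (d : Dec P) (e : Dec Q) {r : ℚ} →
            when d (when e r) ≡ when e (when d r)
when-comm (yes _) (yes _) = refl
when-comm (yes _) (no _)  = refl
when-comm (no _)  (yes _) = refl
when-comm (no _)  (no _)  = refl

when-*ˡ : ∀ {p} {P : Set p} (d : Dec P) (a b : ℚ) → when d (a * b) ≡ a * when d b
when-*ˡ (yes _) a b = refl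
when-*ˡ (no _)  a b = sym (*-zeroʳ a)

when-*ʳ : ∀ {p} {P : Set p} (d : Dec P) (a b : ℚ) → when d (a * b) ≡ when d a * b
when-*ʳ (yes _) a b = refl
when-*ʳ (no _)  a b = sym (*-zeroˡ b)

when-≟-*-subst : ∀ {m} (a b : Fin m) (r : ℚ) (g : Fin m → ℚ) →
                 when (a ≟ b) r * g a ≡ when (a ≟ b) r * g b
when-≟-*-subst a b r g with a ≟ b
... | yes refl = refl
... | no _     = trans (*-zeroˡ (g a)) (sym (*-zeroˡ (g b)))

when-≡-dec-∷ : ∀ {m t} (x y : Fin m) (xs ys : Vec (Fin m) t) {r : ℚ} →
               when (≡-dec _≟_ (x ∷ xs) (y ∷ ys)) r ≡ when (x ≟ y) (when (≡-dec _≟_ xs ys) r)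
when-≡-dec-∷ x y xs ys =
  trans (when-map′ (x ≟ y ×-dec ≡-dec _≟_ xs ys)) (when-×-dec (x ≟ y) (≡-dec _≟_ xs ys))

sumFin≡sum : ∀ n (f : Fin n → ℚ) → sumFin n f ≡ sum f
sumFin≡sum zero    f = refl
sumFin≡sum (suc n) f = cong (f zero +_) (sumFin≡sum n (f ∘ suc))

sumFin-cong : ∀ n {f g : Fin n → ℚ} → f ≗ g → sumFin n f ≡ sumFin n g
sumFin-cong zero    f≗g = refl
sumFin-cong (suc n) f≗g = cong₂ _+_ (f≗g zero) (sumFin-cong n (f≗g ∘ suc))

sumFin-zero : ∀ n → sumFin n (λ _ → 0ℚ) ≡ 0ℚ
sumFin-zero n = trans (sumFin≡sum n _) (sum-replicate-zero n)

sumFin-*ʳ : ∀ n (f : Fin n → ℚ) (q : ℚ) → sumFin n (λ i → f i * q) ≡ sumFin n f * q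
sumFin-*ʳ n f q = begin
  sumFin n (λ i → f i * q) ≡⟨ sumFin≡sum n _ ⟩
  sum (λ i → f i * q)      ≡⟨ sym (*-distribʳ-sum q f) ⟩
  sum f * q                ≡⟨ cong (_* q) (sym (sumFin≡sum n f)) ⟩
  sumFin n f * q           ∎

sumFin-comm : ∀ n m (f : Fin n → Fin m → ℚ) →
              sumFin n (λ i → sumFin m (f i)) ≡ sumFin m (λ j → sumFin n (λ i → f i j))
sumFin-comm n m f = begin
  sumFin n (λ i → sumFin m (f i))          ≡⟨ sumFin≡sum n _ ⟩
  sum (λ i → sumFin m (f i))               ≡⟨ sum-cong-≗ (λ i → sumFin≡sum m (f i)) ⟩
  sum (λ i → sum (f i))                    ≡⟨ ∑-comm f ⟩
  sum (λ j → sum (λ i → f i j))            ≡⟨ sum-cong-≗ (λ j → sumFin≡sum n (λ i → f i j)) ⟨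
  sum (λ j → sumFin n (λ i → f i j))       ≡⟨ sumFin≡sum m _ ⟨
  sumFin m (λ j → sumFin n (λ i → f i j))  ∎

when-sumFin : ∀ {p} {P : Set p} n (d : Dec P) (f : Fin n → ℚ) →
              when d (sumFin n f) ≡ sumFin n (λ i → when d (f i))
when-sumFin n (yes _) f = refl
when-sumFin n (no _)  f = sym (sumFin-zero n)

sumFin-when-≟ : ∀ m (a : Fin m) (g : Fin m → ℚ) → sumFin m (λ j → when (a ≟ j) (g j)) ≡ g a
sumFin-when-≟ (suc m) zero g =
  trans (cong (g zero +_) (sumFin-zero m)) (+-identityʳ (g zero))
sumFin-when-≟ (suc m) (suc a) g = begin
  0ℚ + sumFin m (λ j → when (suc a ≟ suc j) (g (suc j))) ≡⟨ +-identityˡ _ ⟩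
  sumFin m (λ j → when (suc a ≟ suc j) (g (suc j)))      ≡⟨ sumFin-cong m (λ j → when-map′ (a ≟ j)) ⟩
  sumFin m (λ j → when (a ≟ j) (g (suc j)))              ≡⟨ sumFin-when-≟ m a (g ∘ suc) ⟩
  g (suc a)                                              ∎

sumVecs-cong : ∀ n t {f g : Vec (Fin n) t → ℚ} → f ≗ g → sumVecs n t f ≡ sumVecs n t g
sumVecs-cong n zero    f≗g = f≗g []
sumVecs-cong n (suc t) f≗g = sumFin-cong n (λ c → sumVecs-cong n t (λ cs → f≗g (c ∷ cs)))

sumVecs-*ˡ : ∀ n t (q : ℚ) (f : Vec (Fin n) t → ℚ) → sumVecs n t (λ v → q * f v) ≡ q * sumVecs n t f
sumVecs-*ˡ n zero    q f = refl
sumVecs-*ˡ n (suc t) q f = begin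
  sumFin n (λ c → sumVecs n t (λ cs → q * f (c ∷ cs)))
    ≡⟨ sumFin-cong n (λ c → sumVecs-*ˡ n t q (f ∘ (c ∷_))) ⟩
  sumFin n (λ c → q * sumVecs n t (f ∘ (c ∷_)))
    ≡⟨ sumFin≡sum n _ ⟩
  sum (λ c → q * sumVecs n t (f ∘ (c ∷_)))
    ≡⟨ *-distribˡ-sum q (λ c → sumVecs n t (f ∘ (c ∷_))) ⟨
  q * sum (λ c → sumVecs n t (f ∘ (c ∷_)))
    ≡⟨ cong (q *_) (sumFin≡sum n _) ⟨
  q * sumFin n (λ c → sumVecs n t (f ∘ (c ∷_))) ∎

pushforward-cong : ∀ {n m} {f g : Fin n → Fin m} (w : Fin n → ℚ) → f ≗ g →
                   pushforward f w ≗ pushforward g w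
pushforward-cong {n} w f≗g z = sumFin-cong n (λ x → cong (λ a → when (a ≟ z) (w x)) (f≗g x))

pushforward-∘ : ∀ {n k m} (φ : Fin k → Fin m) (f : Fin n → Fin k) (w : Fin n → ℚ) →
                pushforward φ (pushforward f w) ≗ pushforward (φ ∘ f) w
pushforward-∘ {n} {k} φ f w b = begin
  sumFin k (λ c → when (φ c ≟ b) (sumFin n (λ x → when (f x ≟ c) (w x))))
    ≡⟨ sumFin-cong k (λ c → when-sumFin n (φ c ≟ b) _) ⟩
  sumFin k (λ c → sumFin n (λ x → when (φ c ≟ b) (when (f x ≟ c) (w x))))
    ≡⟨ sumFin-comm k n _ ⟩
  sumFin n (λ x → sumFin k (λ c → when (φ c ≟ b) (when (f x ≟ c) (w x))))
    ≡⟨ sumFin-cong n (λ x → sumFin-cong k (λ c → when-comm (φ c ≟ b) (f x ≟ c))) ⟩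
  sumFin n (λ x → sumFin k (λ c → when (f x ≟ c) (when (φ c ≟ b) (w x))))
    ≡⟨ sumFin-cong n (λ x → sumFin-when-≟ k (f x) (λ c → when (φ c ≟ b) (w x))) ⟩
  sumFin n (λ x → when (φ (f x) ≟ b) (w x)) ∎

module Lumping {n m : ℕ} (φ : Fin n → Fin m) where

  IsLumpable : (Fin n → Fin n → ℚ) → (Fin m → Fin m → ℚ) → Set
  IsLumpable K K* = ∀ c → pushforward φ (K c) ≗ K* (φ c)

  sumAbove : ∀ {t} → Vec (Fin m) t → (Vec (Fin n) t → ℚ) → ℚ
  sumAbove {t} bs f = sumVecs n t (λ cs → when (≡-dec _≟_ (map φ cs) bs) (f cs))

  sumAbove-∷ : ∀ {t} (q : Fin n → ℚ) (s : Fin n → Vec (Fin n) t → ℚ) (S : Fin m → ℚ) b bs →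
               (∀ c → sumAbove bs (s c) ≡ S (φ c)) →
               sumAbove (b ∷ bs) (λ cs → q (head cs) * s (head cs) (tail cs)) ≡ pushforward φ q b * S b
  sumAbove-∷ {t} q s S b bs sumAbove-s = begin
    sumAbove (b ∷ bs) (λ cs → q (head cs) * s (head cs) (tail cs))
      ≡⟨ sumFin-cong n (λ c → sumVecs-cong n t (λ cs → split c cs)) ⟩
    sumFin n (λ c → sumVecs n t (λ cs → when (φ c ≟ b) (q c) * when (≡-dec _≟_ (map φ cs) bs) (s c cs)))
      ≡⟨ sumFin-cong n (λ c → sumVecs-*ˡ n t (when (φ c ≟ b) (q c)) (λ cs → when (≡-dec _≟_ (map φ cs) bs) (s c cs))) ⟩
    sumFin n (λ c → when (φ c ≟ b) (q c) * sumAbove bs (s c))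
      ≡⟨ sumFin-cong n (λ c → cong (when (φ c ≟ b) (q c) *_) (sumAbove-s c)) ⟩
    sumFin n (λ c → when (φ c ≟ b) (q c) * S (φ c))
      ≡⟨ sumFin-cong n (λ c → when-≟-*-subst (φ c) b (q c) S) ⟩
    sumFin n (λ c → when (φ c ≟ b) (q c) * S b)
      ≡⟨ sumFin-*ʳ n _ (S b) ⟩
    pushforward φ q b * S b ∎
    where
    split : ∀ c cs → when (≡-dec _≟_ (φ c ∷ map φ cs) (b ∷ bs)) (q c * s c cs)
                     ≡ when (φ c ≟ b) (q c) * when (≡-dec _≟_ (map φ cs) bs) (s c cs)
    split c cs = begin
      when (≡-dec _≟_ (φ c ∷ map φ cs) (b ∷ bs)) (q c * s c cs)
        ≡⟨ when-≡-dec-∷ (φ c) b (map φ cs) bs ⟩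
      when (φ c ≟ b) (when (≡-dec _≟_ (map φ cs) bs) (q c * s c cs))
        ≡⟨ cong (when (φ c ≟ b)) (when-*ˡ (≡-dec _≟_ (map φ cs) bs) (q c) (s c cs)) ⟩
      when (φ c ≟ b) (q c * when (≡-dec _≟_ (map φ cs) bs) (s c cs))
        ≡⟨ when-*ʳ (φ c ≟ b) (q c) _ ⟩
      when (φ c ≟ b) (q c) * when (≡-dec _≟_ (map φ cs) bs) (s c cs) ∎

  module _ {K : Fin n → Fin n → ℚ} {K* : Fin m → Fin m → ℚ} (lumpable : IsLumpable K K*) where

    sumAbove-stepsW : ∀ {t} c (bs : Vec (Fin m) t) → sumAbove bs (stepsW K c) ≡ stepsW K* (φ c) bs
    sumAbove-stepsW c []        = refl
    sumAbove-stepsW c (b ∷ bs) = begin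
      sumAbove (b ∷ bs) (stepsW K c)
        ≡⟨ sumAbove-∷ (K c) (stepsW K) (λ b' → stepsW K* b' bs) b bs (λ c' → sumAbove-stepsW c' bs) ⟩
      pushforward φ (K c) b * stepsW K* b bs
        ≡⟨ cong (_* stepsW K* b bs) (lumpable c b) ⟩
      stepsW K* (φ c) (b ∷ bs) ∎

    imageLaw-lumped : ∀ t (μ : Fin n → ℚ) (bs : Vec (Fin m) (suc t)) →
                      imageLaw t φ μ K bs ≡ pathLaw (pushforward φ μ) K* bs
    imageLaw-lumped t μ (b ∷ bs) =
      sumAbove-∷ μ (stepsW K) (λ b' → stepsW K* b' bs) b bs (λ c → sumAbove-stepsW c bs)

open Lumping using (IsLumpable; imageLaw-lumped)

walkK-lumpable : (A B : FinSemigroup) (φ : Fin (size A) → Fin (size B)) →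
                 (∀ x y → φ (_∙_ A x y) ≡ _∙_ B (φ x) (φ y)) → (w : Fin (size A) → ℚ) →
                 IsLumpable φ (walkK A w) (walkK B (pushforward φ w))
walkK-lumpable A B φ hom w c b = begin
  pushforward φ (pushforward (λ x → _∙_ A x c) w) b    ≡⟨ pushforward-∘ φ (λ x → _∙_ A x c) w b ⟩
  pushforward (λ x → φ (_∙_ A x c)) w b                ≡⟨ pushforward-cong w (λ x → hom x c) b ⟩
  pushforward (λ x → _∙_ B (φ x) (φ c)) w b            ≡⟨ pushforward-∘ (λ z → _∙_ B z (φ c)) φ w b ⟨
  pushforward (λ z → _∙_ B z (φ c)) (pushforward φ w) b ∎

-- The identity holds for arbitrary weights and initial measures; surjectivity, the left ideal and
-- the probability hypotheses only make both sides genuine Markov chains on C and φ(C).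
proposition6p2 : (A B : FinSemigroup) (φ : Fin (size A) → Fin (size B)) → IsEpimorphism A B φ
    → (C : Fin (size A) → Bool) → IsLeftIdeal A C
    → (w : Fin (size A) → ℚ) → IsProbability (size A) w
    → (μ : Fin (size A) → ℚ) → IsDistributionOn (size A) C μ
    → (t : ℕ) (bs : Vec (Fin (size B)) (suc t)) → All (InImage φ C) bs
    → imageLaw t φ μ (walkK A w) bs
    ≡ pathLaw (pushforward φ μ) (walkK B (pushforward φ w)) bs
proposition6p2 A B φ (hom , _) _ _ w _ μ _ t bs _ =
  imageLaw-lumped φ (walkK-lumpable A B φ hom w) t μ bs
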